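{- Let $G=(V,E)$ be a finite simple undirected graph with $m$ edges and let $\lambda\in(0,1)$ with $\lambda>m/(m+1)$. Then a partition of $V$ minimizes the standard LambdaCC objective $$(1-\lambda)\cdot\#\{\text{edges between different clusters}\}+\lambda\cdot\#\{\text{non-adjacent pairs of distinct nodes in a common cluster}\}$$ if and only if it is an optimal solution of cluster deletion on $G$, i.e. a partition of $V$ into cliques of $G$ that minimizes the number of edges of $G$ between different clusters among all partitions of $V$ into cliques.
   Context: A clique of $G$ is a set of nodes that are pairwise adjacent (single nodes are cliques).
   Formalization: The parameter λ ranges over the rationals. -}

module Defs where

open import Data.Nat using (ℕ; zero; suc)
import Data.Nat as ℕ
open import Data.Nat.ListAction using (sum)
open import Data.Product using (_×_)
open import Data.Bool using (Bool; true; false; if_then_else_; not; _∧_)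
open import Data.Fin using (Fin; toℕ)
open import Data.Fin.Properties using (_≟_)
open import Data.List using (List; map; allFin)
open import Data.Nat.Properties using (_<?_)
open import Data.Integer using (+_)
open import Data.Rational using (ℚ; _/_; _*_; _-_; _+_; _≤_; 1ℚ)
open import Relation.Nullary.Decidable using (⌊_⌋)
open import Relation.Binary.PropositionalEquality using (_≡_; _≢_)

record Graph (n : ℕ) : Set where
  field
    adj   : Fin n → Fin n → Bool
    sym   : ∀ i j → adj i j ≡ adj j i
    irrefl : ∀ i → adj i i ≡ false
open Graph public

-- A partition of V = Fin n is given by a cluster-label function:
-- vertices i, j are in a common cluster iff c i ≡ c j.
-- (n labels suffice for any partition of an n-element set.)
Partition : ℕ → Set
Partition n = Fin n → Fin n

sameCluster : ∀ {n} → Partition n → Fin n → Fin n → Bool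
sameCluster c i j = ⌊ c i ≟ c j ⌋

countPairs : ∀ {n} → (Fin n → Fin n → Bool) → ℕ
countPairs {n} P =
  sum (map (λ i → sum (map (λ j →
      if ⌊ toℕ i <? toℕ j ⌋ ∧ P i j then 1 else 0) (allFin n))) (allFin n))

numEdges : ∀ {n} → Graph n → ℕ
numEdges G = countPairs (adj G)

cutEdges : ∀ {n} → Graph n → Partition n → ℕ
cutEdges G c = countPairs (λ i j → adj G i j ∧ not (sameCluster c i j))

missingEdges : ∀ {n} → Graph n → Partition n → ℕ
missingEdges G c = countPairs (λ i j → not (adj G i j) ∧ sameCluster c i j)

ℕtoℚ : ℕ → ℚ
ℕtoℚ k = (+ k) / 1

lambdaCC : ∀ {n} → Graph n → ℚ → Partition n → ℚ
lambdaCC G lam c =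
  (1ℚ - lam) * ℕtoℚ (cutEdges G c) + lam * ℕtoℚ (missingEdges G c)

minimizesLambdaCC : ∀ {n} → Graph n → ℚ → Partition n → Set
minimizesLambdaCC G lam c = ∀ c' → lambdaCC G lam c ≤ lambdaCC G lam c'

IsCliquePartition : ∀ {n} → Graph n → Partition n → Set
IsCliquePartition G c = ∀ i j → i ≢ j → c i ≡ c j → adj G i j ≡ true

IsOptimalClusterDeletion : ∀ {n} → Graph n → Partition n → Set
IsOptimalClusterDeletion G c =
  IsCliquePartition G c × (∀ c' → IsCliquePartition G c' → cutEdges G c ℕ.≤ cutEdges G c')

{-# OPTIONS --safe #-}
-- On a clique partition the LambdaCC cost is (1 - λ)·cut ≤ (1 - λ)·m, which is
-- below λ exactly when λ > m/(m+1); any other partition puts a non-adjacent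
-- pair into one cluster and so costs at least λ. Hence every minimizer is a
-- clique partition (the partition into singletons is one), and on clique
-- partitions the cost is a positive multiple of the number of cut edges.
module Submission where

open import Defs
open import Data.Nat using (ℕ; suc)
open import Data.Integer using (+_)
open import Data.Rational using (ℚ; _/_; _<_; 0ℚ; 1ℚ)
open import Function.Bundles using (_⇔_)

open import Data.Bool using (Bool; true; false; if_then_else_; not; _∧_)
open import Data.Bool.Properties using (∧-conicalˡ; ∧-zeroʳ)
open import Data.Fin using (Fin; toℕ)
open import Data.Fin.Properties using (_≟_; toℕ-injective; <⇒≢)
import Data.Integer as ℤ
import Data.Integer.Properties as ℤₚ
open import Data.List using ([]; _∷_; map; allFin)
open import Data.List.Membership.Propositional using (_∈_)
open import Data.List.Membership.Propositional.Properties using (∈-allFin)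
open import Data.List.Relation.Unary.Any using (here; there)
import Data.Nat as ℕ
import Data.Nat.Properties as ℕₚ
open import Data.Nat.ListAction using (sum)
open import Data.Nat.Coprimality as Coprimality using ()
open import Data.Product using (_,_)
open import Data.Rational
  using (mkℚ; *≤*; toℚᵘ; _≤_; _+_; _*_; _-_; -_; Positive; NonNegative; positive; nonNegative)
open import Data.Rational.Properties
  using ( normalize-coprime; toℚᵘ-injective; toℚᵘ-homo-*; toℚᵘ-fromℚᵘ; pos⇒nonNeg; nonNegative⁻¹
        ; +-identityˡ; +-identityʳ; +-inverseʳ; *-identityʳ; *-zeroʳ; +-monoˡ-<; +-monoˡ-≤
        ; *-monoˡ-≤-nonNeg; *-monoˡ-<-pos; *-cancelˡ-≤-pos; nonNeg*nonNeg⇒nonNeg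
        ; <⇒≤; <-irrefl; <-≤-trans
        ; module ≤-Reasoning )
open import Data.Rational.Solver using (module +-*-Solver)
import Data.Rational.Unnormalised as ℚᵘ
import Data.Rational.Unnormalised.Properties as ℚᵘₚ
open import Data.Sum using (_⊎_; inj₁; inj₂)
open import Function.Base using (case_of_)
open import Function.Bundles using (mk⇔; Equivalence)
open import Relation.Binary.Definitions using (tri<; tri≈; tri>)
open import Relation.Binary.PropositionalEquality as ≡ using (_≡_; _≢_; refl; trans; cong)
open import Relation.Nullary using (yes; no; contradiction)
open import Relation.Nullary.Decidable using (⌊_⌋; isYes≗does; dec-true)

sum-map-mono : ∀ {A : Set} {f g : A → ℕ} → (∀ x → f x ℕ.≤ g x) →
               ∀ xs → sum (map f xs) ℕ.≤ sum (map g xs)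
sum-map-mono f≤g []       = ℕ.z≤n
sum-map-mono f≤g (x ∷ xs) = ℕₚ.+-mono-≤ (f≤g x) (sum-map-mono f≤g xs)

sum-map-≡0 : ∀ {A : Set} {f : A → ℕ} → (∀ x → f x ≡ 0) → ∀ xs → sum (map f xs) ≡ 0
sum-map-≡0 f≡0 []       = refl
sum-map-≡0 f≡0 (x ∷ xs) rewrite f≡0 x = sum-map-≡0 f≡0 xs

∈⇒≤sum-map : ∀ {A : Set} (f : A → ℕ) {x xs} → x ∈ xs → f x ℕ.≤ sum (map f xs)
∈⇒≤sum-map f {xs = y ∷ ys} (here refl) = ℕₚ.m≤m+n (f y) (sum (map f ys))
∈⇒≤sum-map f {xs = y ∷ ys} (there x∈ys) =
  ℕₚ.≤-trans (∈⇒≤sum-map f x∈ys) (ℕₚ.m≤n+m (sum (map f ys)) (f y))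

module _ {n : ℕ} where

  pairIndicator : (Fin n → Fin n → Bool) → Fin n → Fin n → ℕ
  pairIndicator P i j = if ⌊ toℕ i ℕₚ.<? toℕ j ⌋ ∧ P i j then 1 else 0

  pairIndicator-mono : ∀ {P Q} → (∀ i j → toℕ i ℕ.< toℕ j → P i j ≡ true → Q i j ≡ true) →
                       ∀ i j → pairIndicator P i j ℕ.≤ pairIndicator Q i j
  pairIndicator-mono {P} P⇒Q i j with toℕ i ℕₚ.<? toℕ j
  ... | no  _   = ℕ.z≤n
  ... | yes i<j with P i j in Pij
  ...   | false = ℕ.z≤n
  ...   | true  rewrite P⇒Q i j i<j Pij = ℕₚ.≤-refl

  pairIndicator≡0 : ∀ {P} → (∀ i j → toℕ i ℕ.< toℕ j → P i j ≡ false) →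
                    ∀ i j → pairIndicator P i j ≡ 0
  pairIndicator≡0 ¬P i j with toℕ i ℕₚ.<? toℕ j
  ... | no  _   = refl
  ... | yes i<j rewrite ¬P i j i<j = refl

  pairIndicator≡1 : ∀ {P i j} → toℕ i ℕ.< toℕ j → P i j ≡ true → pairIndicator P i j ≡ 1
  pairIndicator≡1 {i = i} {j} i<j Pij with toℕ i ℕₚ.<? toℕ j
  ... | no  i≮j = contradiction i<j i≮j
  ... | yes _   rewrite Pij = refl

  countPairs-mono : ∀ {P Q} → (∀ i j → toℕ i ℕ.< toℕ j → P i j ≡ true → Q i j ≡ true) →
                    countPairs P ℕ.≤ countPairs Q
  countPairs-mono P⇒Q =
    sum-map-mono (λ i → sum-map-mono (pairIndicator-mono P⇒Q i) (allFin n)) (allFin n)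

  countPairs≡0 : ∀ {P} → (∀ i j → toℕ i ℕ.< toℕ j → P i j ≡ false) → countPairs P ≡ 0
  countPairs≡0 ¬P = sum-map-≡0 (λ i → sum-map-≡0 (pairIndicator≡0 ¬P i) (allFin n)) (allFin n)

  <⇒countPairs>0 : ∀ {P i j} → toℕ i ℕ.< toℕ j → P i j ≡ true → 0 ℕ.< countPairs P
  <⇒countPairs>0 {P} {i} {j} i<j Pij = begin
    1                                        ≡⟨ pairIndicator≡1 {P} i<j Pij ⟨
    pairIndicator P i j                      ≤⟨ ∈⇒≤sum-map (pairIndicator P i) (∈-allFin j) ⟩
    sum (map (pairIndicator P i) (allFin n)) ≤⟨ ∈⇒≤sum-map _ (∈-allFin i) ⟩
    countPairs P                             ∎
    where open ℕₚ.≤-Reasoning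

  ≢⇒countPairs>0 : ∀ {P i j} → i ≢ j → P i j ≡ true → P j i ≡ true → 0 ℕ.< countPairs P
  ≢⇒countPairs>0 {P} {i} {j} i≢j Pij Pji with ℕₚ.<-cmp (toℕ i) (toℕ j)
  ... | tri< i<j _   _   = <⇒countPairs>0 {P} i<j Pij
  ... | tri≈ _   i≡j _   = contradiction (toℕ-injective i≡j) i≢j
  ... | tri> _   _   j<i = <⇒countPairs>0 {P} j<i Pji

module _ {n : ℕ} (G : Graph n) where

  cutEdges≤numEdges : ∀ c → cutEdges G c ℕ.≤ numEdges G
  cutEdges≤numEdges c = countPairs-mono (λ i j _ → ∧-conicalˡ (adj G i j) _)

  missingPair : ∀ {c : Partition n} {i j} → adj G i j ≡ false → c i ≡ c j →
                not (adj G i j) ∧ sameCluster c i j ≡ true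
  missingPair {c} {i} {j} ¬adj same rewrite ¬adj =
    trans (isYes≗does (c i ≟ c j)) (dec-true (c i ≟ c j) same)

  missingEdges>0 : ∀ c {i j} → i ≢ j → c i ≡ c j → adj G i j ≡ false → 0 ℕ.< missingEdges G c
  missingEdges>0 c {i} {j} i≢j same ¬adj =
    ≢⇒countPairs>0 i≢j (missingPair ¬adj same) (missingPair (trans (Graph.sym G j i) ¬adj) (≡.sym same))

  isCliquePartition⇒missingEdges≡0 : ∀ {c} → IsCliquePartition G c → missingEdges G c ≡ 0
  isCliquePartition⇒missingEdges≡0 {c} clique = countPairs≡0 noMissingPair
    where
    noMissingPair : ∀ i j → toℕ i ℕ.< toℕ j → not (adj G i j) ∧ sameCluster c i j ≡ false
    noMissingPair i j i<j with c i ≟ c j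
    ... | yes same rewrite clique i j (<⇒≢ i<j) same = refl
    ... | no  _    = ∧-zeroʳ (not (adj G i j))

  missingEdges≡0⇒isCliquePartition : ∀ c → missingEdges G c ≡ 0 → IsCliquePartition G c
  missingEdges≡0⇒isCliquePartition c none i j i≢j same with adj G i j in adjij
  ... | true  = refl
  ... | false = contradiction none (ℕₚ.n>0⇒n≢0 (missingEdges>0 c i≢j same adjij))

  isCliquePartition⊎missingEdges>0 : ∀ c → IsCliquePartition G c ⊎ 0 ℕ.< missingEdges G c
  isCliquePartition⊎missingEdges>0 c with missingEdges G c in missing
  ... | ℕ.zero = inj₁ (missingEdges≡0⇒isCliquePartition c missing)
  ... | suc _  = inj₂ (ℕ.s≤s ℕ.z≤n)

  discrete-isCliquePartition : IsCliquePartition G (λ i → i)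
  discrete-isCliquePartition i j i≢j i≡j = contradiction i≡j i≢j

ℕtoℚ≡mkℚ : ∀ k → ℕtoℚ k ≡ mkℚ (+ k) 0 (Coprimality.sym (Coprimality.1-coprimeTo k))
ℕtoℚ≡mkℚ k = normalize-coprime (Coprimality.sym (Coprimality.1-coprimeTo k))

ℕtoℚ-nonNeg : ∀ k → NonNegative (ℕtoℚ k)
ℕtoℚ-nonNeg k rewrite ℕtoℚ≡mkℚ k = _

ℕtoℚ-suc-pos : ∀ k → Positive (ℕtoℚ (suc k))
ℕtoℚ-suc-pos k rewrite ℕtoℚ≡mkℚ (suc k) = _

ℕtoℚ-mono-≤ : ∀ {k l} → k ℕ.≤ l → ℕtoℚ k ≤ ℕtoℚ l
ℕtoℚ-mono-≤ {k} {l} k≤l rewrite ℕtoℚ≡mkℚ k | ℕtoℚ≡mkℚ l =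
  *≤* (ℤₚ.*-monoʳ-≤-nonNeg (+ 1) (ℤ.+≤+ k≤l))

ℕtoℚ-cancel-≤ : ∀ {k l} → ℕtoℚ k ≤ ℕtoℚ l → k ℕ.≤ l
ℕtoℚ-cancel-≤ {k} {l} k≤l rewrite ℕtoℚ≡mkℚ k | ℕtoℚ≡mkℚ l with k≤l
... | *≤* k*1≤l*1 = ℤ.drop‿+≤+ (ℤₚ.*-cancelʳ-≤-pos (+ k) (+ l) (+ 1) k*1≤l*1)

ℕtoℚ-suc : ∀ k → ℕtoℚ (suc k) ≡ ℕtoℚ k + 1ℚ
ℕtoℚ-suc k rewrite ℕtoℚ≡mkℚ k =
  cong (_/ 1) (≡.sym (trans (cong (ℤ._+ + 1) (ℤₚ.*-identityʳ (+ k))) (ℤₚ.+-comm (+ k) (+ 1))))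

m/[1+m]*[1+m]≡m : ∀ m → ((+ m) / suc m) * ℕtoℚ (suc m) ≡ ℕtoℚ m
m/[1+m]*[1+m]≡m m = toℚᵘ-injective (begin
  toℚᵘ (m/[1+m] * ℕtoℚ (suc m))              ≈⟨ toℚᵘ-homo-* m/[1+m] (ℕtoℚ (suc m)) ⟩
  toℚᵘ m/[1+m] ℚᵘ.* toℚᵘ (ℕtoℚ (suc m))      ≈⟨ ℚᵘₚ.*-cong (toℚᵘ-fromℚᵘ (ℚᵘ.mkℚᵘ (+ m) m))
                                                             (toℚᵘ-fromℚᵘ (ℚᵘ.mkℚᵘ (+ suc m) 0)) ⟩
  ℚᵘ.mkℚᵘ (+ m) m ℚᵘ.* ℚᵘ.mkℚᵘ (+ suc m) 0  ≈⟨ ℚᵘ.*≡* cross-multiplied ⟩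
  ℚᵘ.mkℚᵘ (+ m) 0                            ≈⟨ toℚᵘ-fromℚᵘ _ ⟨
  toℚᵘ (ℕtoℚ m)                              ∎)
  where
  open ℚᵘₚ.≃-Reasoning
  m/[1+m] : ℚ
  m/[1+m] = (+ m) / suc m
  cross-multiplied : (+ m ℤ.* + suc m) ℤ.* + 1 ≡ + m ℤ.* + (suc m ℕ.* 1)
  cross-multiplied = trans (ℤₚ.*-identityʳ _)
                           (cong (λ d → + m ℤ.* + d) (≡.sym (ℕₚ.*-identityʳ (suc m))))

m/[1+m]<λ⇒[1-λ]*m<λ : ∀ m {lam} → (+ m) / suc m < lam → (1ℚ - lam) * ℕtoℚ m < lam
m/[1+m]<λ⇒[1-λ]*m<λ m {lam} m/[1+m]<λ = begin-strict
  (1ℚ - lam) * x            ≡⟨ solve 2 (λ l y → (con 1ℚ :- l) :* y := y :- l :* y) refl lam x ⟩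
  x - lam * x               <⟨ +-monoˡ-< (- (lam * x)) x<λ[x+1] ⟩
  lam * (x + 1ℚ) - lam * x  ≡⟨ solve 2 (λ l y → l :* (y :+ con 1ℚ) :- l :* y := l) refl lam x ⟩
  lam                       ∎
  where
  open ≤-Reasoning
  open +-*-Solver
  x : ℚ
  x = ℕtoℚ m
  x<λ[x+1] : x < lam * (x + 1ℚ)
  x<λ[x+1] = begin-strict
    x                               ≡⟨ m/[1+m]*[1+m]≡m m ⟨
    ((+ m) / suc m) * ℕtoℚ (suc m)  <⟨ *-monoˡ-<-pos (ℕtoℚ (suc m)) {{ℕtoℚ-suc-pos m}} m/[1+m]<λ ⟩
    lam * ℕtoℚ (suc m)              ≡⟨ cong (lam *_) (ℕtoℚ-suc m) ⟩
    lam * (x + 1ℚ)                  ∎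

p<q⇒0<q-p : ∀ {p q} → p < q → 0ℚ < q - p
p<q⇒0<q-p {p} {q} p<q = begin-strict
  0ℚ     ≡⟨ +-inverseʳ p ⟨
  p - p  <⟨ +-monoˡ-< (- p) p<q ⟩
  q - p  ∎
  where open ≤-Reasoning

isCliquePartition⇒lambdaCC≡[1-λ]*cutEdges : ∀ {n} (G : Graph n) lam {c} → IsCliquePartition G c →
                                            lambdaCC G lam c ≡ (1ℚ - lam) * ℕtoℚ (cutEdges G c)
isCliquePartition⇒lambdaCC≡[1-λ]*cutEdges G lam {c} clique = begin
  cost + lam * ℕtoℚ (missingEdges G c)  ≡⟨ cong (λ k → cost + lam * ℕtoℚ k) no-missing-edges ⟩
  cost + lam * ℕtoℚ 0                   ≡⟨ cong (λ y → cost + y) (*-zeroʳ lam) ⟩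
  cost + 0ℚ                             ≡⟨ +-identityʳ cost ⟩
  cost                                  ∎
  where
  open ≡.≡-Reasoning
  cost : ℚ
  cost = (1ℚ - lam) * ℕtoℚ (cutEdges G c)
  no-missing-edges : missingEdges G c ≡ 0
  no-missing-edges = isCliquePartition⇒missingEdges≡0 G clique

module CliqueThreshold {n : ℕ} (G : Graph n) {lam : ℚ} (0<λ : 0ℚ < lam) (λ<1 : lam < 1ℚ) where

  private instance
    λ-nonNeg : NonNegative lam
    λ-nonNeg = nonNegative (<⇒≤ 0<λ)

    1-λ-pos : Positive (1ℚ - lam)
    1-λ-pos = positive (p<q⇒0<q-p λ<1)

    1-λ-nonNeg : NonNegative (1ℚ - lam)
    1-λ-nonNeg = pos⇒nonNeg (1ℚ - lam)

  missingEdges>0⇒λ≤lambdaCC : ∀ c → 0 ℕ.< missingEdges G c → lam ≤ lambdaCC G lam c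
  missingEdges>0⇒λ≤lambdaCC c missing>0 = begin
    lam                                 ≡⟨ *-identityʳ lam ⟨
    lam * ℕtoℚ 1                        ≤⟨ *-monoˡ-≤-nonNeg lam (ℕtoℚ-mono-≤ missing>0) ⟩
    lam * ℕtoℚ (missingEdges G c)       ≡⟨ +-identityˡ _ ⟨
    0ℚ + lam * ℕtoℚ (missingEdges G c)  ≤⟨ +-monoˡ-≤ (lam * ℕtoℚ (missingEdges G c)) cost≥0 ⟩
    lambdaCC G lam c                    ∎
    where
    open ≤-Reasoning
    cost≥0 : 0ℚ ≤ (1ℚ - lam) * ℕtoℚ (cutEdges G c)
    cost≥0 = nonNegative⁻¹ _
      {{nonNeg*nonNeg⇒nonNeg (1ℚ - lam) (ℕtoℚ (cutEdges G c)) {{ℕtoℚ-nonNeg (cutEdges G c)}}}}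

  isCliquePartition⇒lambdaCC<λ : (+ numEdges G) / suc (numEdges G) < lam →
                                 ∀ {c} → IsCliquePartition G c → lambdaCC G lam c < lam
  isCliquePartition⇒lambdaCC<λ m/[1+m]<λ {c} clique = begin-strict
    lambdaCC G lam c                  ≡⟨ isCliquePartition⇒lambdaCC≡[1-λ]*cutEdges G lam clique ⟩
    (1ℚ - lam) * ℕtoℚ (cutEdges G c)  ≤⟨ *-monoˡ-≤-nonNeg (1ℚ - lam) (ℕtoℚ-mono-≤ (cutEdges≤numEdges G c)) ⟩
    (1ℚ - lam) * ℕtoℚ (numEdges G)    <⟨ m/[1+m]<λ⇒[1-λ]*m<λ (numEdges G) m/[1+m]<λ ⟩
    lam                               ∎
    where open ≤-Reasoning

  lambdaCC-≤⇔cutEdges-≤ : ∀ {c c′} → IsCliquePartition G c → IsCliquePartition G c′ →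
                          lambdaCC G lam c ≤ lambdaCC G lam c′ ⇔ cutEdges G c ℕ.≤ cutEdges G c′
  lambdaCC-≤⇔cutEdges-≤ {c} {c′} clique clique′ = mk⇔
    (λ cost≤ → ℕtoℚ-cancel-≤ (*-cancelˡ-≤-pos (1ℚ - lam) (≡.subst₂ _≤_ cost≡ cost′≡ cost≤)))
    (λ cut≤ → ≡.subst₂ _≤_ (≡.sym cost≡) (≡.sym cost′≡)
                         (*-monoˡ-≤-nonNeg (1ℚ - lam) (ℕtoℚ-mono-≤ cut≤)))
    where
    cost≡ : lambdaCC G lam c ≡ (1ℚ - lam) * ℕtoℚ (cutEdges G c)
    cost≡ = isCliquePartition⇒lambdaCC≡[1-λ]*cutEdges G lam clique
    cost′≡ : lambdaCC G lam c′ ≡ (1ℚ - lam) * ℕtoℚ (cutEdges G c′)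
    cost′≡ = isCliquePartition⇒lambdaCC≡[1-λ]*cutEdges G lam clique′

corollary1 : (n : ℕ) (G : Graph n) (lam : ℚ) →
    0ℚ < lam → lam < 1ℚ → ((+ numEdges G) / suc (numEdges G)) < lam →
    (c : Partition n) → minimizesLambdaCC G lam c ⇔ IsOptimalClusterDeletion G c
corollary1 n G lam 0<λ λ<1 m/[1+m]<λ c = mk⇔ minimizer⇒optimal optimal⇒minimizer
  where
  open CliqueThreshold G 0<λ λ<1
  open ≤-Reasoning

  minimizer⇒optimal : minimizesLambdaCC G lam c → IsOptimalClusterDeletion G c
  minimizer⇒optimal minimizer = case isCliquePartition⊎missingEdges>0 G c of λ where
    (inj₁ clique)    → clique , λ c′ clique′ →
      Equivalence.to (lambdaCC-≤⇔cutEdges-≤ clique clique′) (minimizer c′)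
    (inj₂ missing>0) → contradiction (begin-strict
      lam                       ≤⟨ missingEdges>0⇒λ≤lambdaCC c missing>0 ⟩
      lambdaCC G lam c          ≤⟨ minimizer (λ i → i) ⟩
      lambdaCC G lam (λ i → i)  <⟨ isCliquePartition⇒lambdaCC<λ m/[1+m]<λ (discrete-isCliquePartition G) ⟩
      lam                       ∎) (<-irrefl refl)

  optimal⇒minimizer : IsOptimalClusterDeletion G c → minimizesLambdaCC G lam c
  optimal⇒minimizer (clique , optimal) c′ = case isCliquePartition⊎missingEdges>0 G c′ of λ where
    (inj₁ clique′)   → Equivalence.from (lambdaCC-≤⇔cutEdges-≤ clique clique′) (optimal c′ clique′)
    (inj₂ missing>0) → begin
      lambdaCC G lam c   <⟨ isCliquePartition⇒lambdaCC<λ m/[1+m]<λ clique ⟩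
      lam                ≤⟨ missingEdges>0⇒λ≤lambdaCC c′ missing>0 ⟩
      lambdaCC G lam c′  ∎
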